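{- Let $\lambda=(\lambda_1,\dots,\lambda_n)$ be a Ferrers board (positive integers $\lambda_1\le\dots\le\lambda_n$) with $\lambda_i\ge i$ for all $i$, let $m$ be a positive integer with $m\le\lambda_1+1$, and let $\lambda^+=(m,\lambda_1+1,\dots,\lambda_n+1)$. Then for every $1\le i\le m$, \[ Q^{\lambda^+}_i(t)=\sum_{j=1}^{i-1}Q^\lambda_j(t)+t\sum_{j=i}^{\lambda_1}Q^\lambda_j(t). \]
   Context: For a Ferrers board $\nu=(\nu_1,\dots,\nu_k)$, a row-complete rook placement on $\nu$ is a word $\sigma=\sigma_1\cdots\sigma_k$ of distinct positive integers with $1\le\sigma_r\le\nu_r$ for all $r$; $S_\nu$ is the set of these. An ascent of $\sigma$ is an index $r\in[k-1]$ with $\sigma_r<\sigma_{r+1}$, and $\operatorname{asc}(\sigma)$ is their number. For $1\le i\le\nu_1$, $Q^\nu_i(t)=\sum_{\sigma\in S_\nu,\ \sigma_1=i}t^{\operatorname{asc}(\sigma)}$. -}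

module Defs where

open import Data.Nat using (ℕ; zero; suc; _+_; _∸_; _<_; _≤_; _≟_)
open import Data.Nat.Properties using (_<?_)
open import Data.List using (List; []; _∷_; map; concatMap; filter; length; upTo)
open import Data.Nat.ListAction using (sum)
open import Data.Bool using (if_then_else_)
open import Data.List.Relation.Unary.Unique.DecPropositional _≟_ using (Unique; unique?)
open import Data.Product using (_×_)
open import Relation.Nullary using (Dec; yes; no; does)
open import Relation.Nullary.Decidable using (_×-dec_)
open import Relation.Binary.PropositionalEquality using (_≡_)

fromTo : ℕ → ℕ → List ℕ
fromTo a b = map (a +_) (upTo (suc b ∸ a))

boundedWords : List ℕ → List (List ℕ)
boundedWords []      = [] ∷ []
boundedWords (a ∷ ν) = concatMap (λ x → map (x ∷_) (boundedWords ν)) (fromTo 1 a)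

-- S_ν : row-complete rook placements = bounded words with distinct entries.
S : List ℕ → List (List ℕ)
S ν = filter (λ σ → unique? σ) (boundedWords ν)

ascFrom : ℕ → List ℕ → ℕ
ascFrom x []      = 0
ascFrom x (y ∷ σ) = (if does (x <? y) then 1 else 0) + ascFrom y σ

asc : List ℕ → ℕ
asc []      = 0
asc (x ∷ σ) = ascFrom x σ

startsWith : ℕ → List ℕ → Set
startsWith i []      = 0 ≡ 1
startsWith i (x ∷ _) = x ≡ i

startsWith? : (i : ℕ) (σ : List ℕ) → Dec (startsWith i σ)
startsWith? i []      = 0 ≟ 1
startsWith? i (x ∷ _) = x ≟ i

-- Polynomials in t with ℕ coefficients, as coefficient functions: p d = [t^d] p.
Poly : Set
Poly = ℕ → ℕ

Q : List ℕ → ℕ → Poly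
Q ν i d = length (filter (λ σ → startsWith? i σ ×-dec (asc σ ≟ d)) (S ν))

ΣQ : List ℕ → ℕ → ℕ → Poly
ΣQ ν a b d = sum (map (λ j → Q ν j d) (fromTo a b))

_⊕_ : Poly → Poly → Poly
(p ⊕ q) d = p d + q d

t·_ : Poly → Poly
(t· p) zero    = 0
(t· p) (suc d) = p d

_≐_ : Poly → Poly → Set
p ≐ q = ∀ d → p d ≡ q d

module Submission where

-- A word in S_{λ⁺} starting with i is i ∷ τ, where τ is a rook placement on
-- (λ₁+1, …, λₙ+1) avoiding the value i. Because i ≤ λ_r + 1 for every row, deleting
-- the value i and closing the gap (the inverse of punchIn i) is a bijection from such
-- τ onto the words bounded by λ. It is strictly monotone, so it preserves distinctness
-- and every ascent of τ, while the first comparison i < τ₁ becomes i ≤ ρ₁ for the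
-- image ρ. Grouping ρ by its first entry j therefore gives Q^λ_j for j < i and
-- t·Q^λ_j for j ≥ i.

open import Defs
open import Data.Nat using (ℕ; zero; suc; _+_; _∸_; _<_; _≤_; _≟_; z≤n; s≤s; s<s; s≤s⁻¹)
open import Data.Nat.Properties
open import Data.Bool using (Bool; true; false; _∧_; not; if_then_else_)
open import Data.Bool.Properties using (∧-assoc; ∧-zeroʳ)
open import Data.List using (List; []; _∷_; map; length; lookup; _++_; concat; filter; applyUpTo)
open import Data.List.Properties using (map-∘)
open import Data.Nat.ListAction using (sum)
open import Data.List.Relation.Unary.All using (All; []; _∷_; all?)
open import Data.List.Relation.Unary.Linked using (Linked)
open import Data.List.Relation.Unary.Linked.Properties using (Linked⇒All)
open import Data.List.Relation.Unary.Unique.DecPropositional _≟_ using (unique?)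
import Data.List.Relation.Unary.Unique.Propositional.Properties as Unique
open import Data.Fin using (Fin; toℕ)
open import Function using (_∘_; _⇔_; mk⇔)
open import Relation.Binary.PropositionalEquality
open import Relation.Binary.Definitions using (tri<; tri≈; tri>)
open import Relation.Nullary using (does; yes; no; contradiction)
open import Relation.Nullary.Decidable using (¬?; dec-true; dec-false; does-⇔)
open import Relation.Unary using (Decidable)
open import Algebra.Properties.CommutativeSemigroup +-commutativeSemigroup using (x∙yz≈y∙xz)

module _ {A : Set} where

  count : (A → Bool) → List A → ℕ
  count P []       = 0
  count P (x ∷ xs) = (if P x then 1 else 0) + count P xs

  count-cong : ∀ {P Q} xs → (∀ x → P x ≡ Q x) → count P xs ≡ count Q xs
  count-cong []       P≗Q = refl
  count-cong (x ∷ xs) P≗Q = cong₂ (λ b n → (if b then 1 else 0) + n) (P≗Q x) (count-cong xs P≗Q)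

  count-false : ∀ {P} xs → (∀ x → P x ≡ false) → count P xs ≡ 0
  count-false []       P≗false = refl
  count-false (x ∷ xs) P≗false rewrite P≗false x = count-false xs P≗false

  count-++ : ∀ P xs ys → count P (xs ++ ys) ≡ count P xs + count P ys
  count-++ P []       ys = refl
  count-++ P (x ∷ xs) ys =
    trans (cong (_ +_) (count-++ P xs ys)) (sym (+-assoc (if P x then 1 else 0) _ _))

  count-concat : ∀ P xss → count P (concat xss) ≡ sum (map (count P) xss)
  count-concat P []         = refl
  count-concat P (xs ∷ xss) = trans (count-++ P xs (concat xss)) (cong (count P xs +_) (count-concat P xss))

  count-filter : ∀ {p} {R : A → Set p} (R? : Decidable R) P xs →
                 count P (filter R? xs) ≡ count (λ x → does (R? x) ∧ P x) xs
  count-filter R? P []       = refl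
  count-filter R? P (x ∷ xs) with does (R? x)
  ... | true  = cong (_ +_) (count-filter R? P xs)
  ... | false = count-filter R? P xs

  length-filter≡count : ∀ {p} {R : A → Set p} (R? : Decidable R) xs →
                  length (filter R? xs) ≡ count (does ∘ R?) xs
  length-filter≡count R? []       = refl
  length-filter≡count R? (x ∷ xs) with does (R? x)
  ... | true  = cong suc (length-filter≡count R? xs)
  ... | false = length-filter≡count R? xs

count-map : ∀ {A B : Set} P (f : A → B) xs → count P (map f xs) ≡ count (P ∘ f) xs
count-map P f []       = refl
count-map P f (x ∷ xs) = cong (_ +_) (count-map P f xs)

sumRange : (ℕ → ℕ) → ℕ → ℕ → ℕ
sumRange f a zero    = 0
sumRange f a (suc n) = f a + sumRange f (suc a) n

sumRange-cong : ∀ {f g} a n → (∀ k → a ≤ k → k < a + n → f k ≡ g k) → sumRange f a n ≡ sumRange g a n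
sumRange-cong a zero    f≗g = refl
sumRange-cong a (suc n) f≗g = cong₂ _+_ (f≗g a ≤-refl (m<m+n a (s≤s z≤n)))
  (sumRange-cong (suc a) n (λ k a<k k<a+1+n → f≗g k (<⇒≤ a<k) (subst (k <_) (sym (+-suc a n)) k<a+1+n)))

sumRange-+ : ∀ f a m n → sumRange f a (m + n) ≡ sumRange f a m + sumRange f (a + m) n
sumRange-+ f a zero    n = cong (λ b → sumRange f b n) (sym (+-identityʳ a))
sumRange-+ f a (suc m) n = begin
  f a + sumRange f (suc a) (m + n)                        ≡⟨ cong (f a +_) (sumRange-+ f (suc a) m n) ⟩
  f a + (sumRange f (suc a) m + sumRange f (suc a + m) n) ≡⟨ cong (λ b → f a + (sumRange f (suc a) m + sumRange f b n)) (sym (+-suc a m)) ⟩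
  f a + (sumRange f (suc a) m + sumRange f (a + suc m) n) ≡⟨ sym (+-assoc (f a) _ _) ⟩
  f a + sumRange f (suc a) m + sumRange f (a + suc m) n   ∎
  where open ≡-Reasoning

sumRange-suc : ∀ f a n → sumRange (f ∘ suc) a n ≡ sumRange f (suc a) n
sumRange-suc f a zero    = refl
sumRange-suc f a (suc n) = cong (f (suc a) +_) (sumRange-suc f (suc a) n)

sumRange-zero : ∀ {f} a n → (∀ k → a ≤ k → f k ≡ 0) → sumRange f a n ≡ 0
sumRange-zero a zero    f≗0 = refl
sumRange-zero a (suc n) f≗0 rewrite f≗0 a ≤-refl = sumRange-zero (suc a) n (λ k a<k → f≗0 k (<⇒≤ a<k))

sumRange-single : ∀ {f} a n j → a ≤ j → j < a + n → (∀ k → k ≢ j → f k ≡ 0) → sumRange f a n ≡ f j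
sumRange-single a zero j a≤j j<a+0 f≗0 = contradiction (subst (j <_) (+-identityʳ a) j<a+0) (≤⇒≯ a≤j)
sumRange-single {f} a (suc n) j a≤j j<a+1+n f≗0 with a ≟ j
... | yes refl = trans (cong (f a +_) (sumRange-zero (suc a) n (λ k a<k → f≗0 k (>⇒≢ a<k)))) (+-identityʳ (f a))
... | no a≢j   = trans (cong (_+ sumRange f (suc a) n) (f≗0 a a≢j))
                       (sumRange-single (suc a) n j (≤∧≢⇒< a≤j a≢j) (subst (j <_) (+-suc a n) j<a+1+n) f≗0)

sum-fromTo : ∀ f a b → sum (map f (fromTo a b)) ≡ sumRange f a (suc b ∸ a)
sum-fromTo f a b = go (suc b ∸ a) (λ k → k) a (λ _ → refl)
  where
  go : ∀ n h c → (∀ k → a + h k ≡ c + k) → sum (map f (map (a +_) (applyUpTo h n))) ≡ sumRange f c n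
  go zero    h c a+h≗c+ = refl
  go (suc n) h c a+h≗c+ = cong₂ _+_ (cong f (trans (a+h≗c+ 0) (+-identityʳ c)))
                                    (go n (h ∘ suc) (suc c) (λ k → trans (a+h≗c+ (suc k)) (+-suc c k)))

punchIn : ℕ → ℕ → ℕ
punchIn p x with x <? p
... | yes _ = x
... | no  _ = suc x

punchIn-< : ∀ {p x} → x < p → punchIn p x ≡ x
punchIn-< {p} {x} x<p with x <? p
... | yes _   = refl
... | no  x≮p = contradiction x<p x≮p

punchIn-≥ : ∀ {p x} → p ≤ x → punchIn p x ≡ suc x
punchIn-≥ {p} {x} p≤x with x <? p
... | yes x<p = contradiction x<p (≤⇒≯ p≤x)
... | no  _   = refl

punchIn-≢ : ∀ p x → punchIn p x ≢ p
punchIn-≢ p x with x <? p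
... | yes x<p = <⇒≢ x<p
... | no  x≮p = λ x+1≡p → x≮p (subst (x <_) x+1≡p ≤-refl)

punchIn-mono-< : ∀ p {x y} → x < y → punchIn p x < punchIn p y
punchIn-mono-< p {x} {y} x<y with x <? p | y <? p
... | yes _   | yes _   = x<y
... | yes _   | no  _   = m<n⇒m<1+n x<y
... | no  x≮p | yes y<p = contradiction (<-trans x<y y<p) x≮p
... | no  _   | no  _   = s<s x<y

module _ {f : ℕ → ℕ} (f-mono : ∀ {x y} → x < y → f x < f y) where

  strictMono⇒injective : ∀ {x y} → f x ≡ f y → x ≡ y
  strictMono⇒injective {x} {y} fx≡fy with <-cmp x y
  ... | tri< x<y _ _ = contradiction fx≡fy (<⇒≢ (f-mono x<y))
  ... | tri≈ _ x≡y _ = x≡y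
  ... | tri> _ _ y<x = contradiction (sym fx≡fy) (<⇒≢ (f-mono y<x))

  strictMono⇒cancel-< : ∀ {x y} → f x < f y → x < y
  strictMono⇒cancel-< {x} {y} fx<fy with <-cmp x y
  ... | tri< x<y _ _    = x<y
  ... | tri≈ _ refl _   = contradiction fx<fy (<-irrefl refl)
  ... | tri> _ _ y<x    = contradiction (f-mono y<x) (<⇒≯ fx<fy)

sumRange-punchIn : ∀ f a {q n} → q ≤ n →
  sumRange f a (suc n) ≡ f (a + q) + sumRange (f ∘ punchIn (a + q)) a n
sumRange-punchIn f a {q} {n} q≤n = begin
  sumRange f a (suc n)
    ≡⟨ cong (sumRange f a) 1+n≡q+1+r ⟩
  sumRange f a (q + suc r)
    ≡⟨ sumRange-+ f a q (suc r) ⟩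
  sumRange f a q + (f p + sumRange f (suc p) r)
    ≡⟨ x∙yz≈y∙xz (sumRange f a q) (f p) _ ⟩
  f p + (sumRange f a q + sumRange f (suc p) r)
    ≡⟨ cong (f p +_) (cong₂ _+_ below above) ⟩
  f p + (sumRange (f ∘ punchIn p) a q + sumRange (f ∘ punchIn p) p r)
    ≡⟨ cong (f p +_) (sym (sumRange-+ (f ∘ punchIn p) a q r)) ⟩
  f p + sumRange (f ∘ punchIn p) a (q + r)
    ≡⟨ cong (λ k → f p + sumRange (f ∘ punchIn p) a k) (m+[n∸m]≡n q≤n) ⟩
  f p + sumRange (f ∘ punchIn p) a n
    ∎
  where
  open ≡-Reasoning
  p = a + q
  r = n ∸ q
  1+n≡q+1+r : suc n ≡ q + suc r
  1+n≡q+1+r = trans (cong suc (sym (m+[n∸m]≡n q≤n))) (sym (+-suc q r))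
  below : sumRange f a q ≡ sumRange (f ∘ punchIn p) a q
  below = sumRange-cong a q (λ k _ k<p → cong f (sym (punchIn-< k<p)))
  above : sumRange f (suc p) r ≡ sumRange (f ∘ punchIn p) p r
  above = trans (sym (sumRange-suc f p r)) (sumRange-cong p r (λ k p≤k _ → cong f (sym (punchIn-≥ p≤k))))

unique : List ℕ → Bool
unique σ = does (unique? σ)

avoids : ℕ → List ℕ → Bool
avoids p τ = does (all? (λ y → ¬? (p ≟ y)) τ)

countWords : List ℕ → (List ℕ → Bool) → ℕ
countWords ν P = count P (boundedWords ν)

countWords-cons : ∀ a ν P → countWords (a ∷ ν) P ≡ sumRange (λ x → countWords ν (P ∘ (x ∷_))) 1 a
countWords-cons a ν P = begin
  count P (concat (map words (fromTo 1 a)))   ≡⟨ count-concat P (map words (fromTo 1 a)) ⟩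
  sum (map (count P) (map words (fromTo 1 a))) ≡⟨ cong sum (sym (map-∘ (fromTo 1 a))) ⟩
  sum (map (count P ∘ words) (fromTo 1 a))     ≡⟨ sum-fromTo (count P ∘ words) 1 a ⟩
  sumRange (count P ∘ words) 1 a               ≡⟨ sumRange-cong 1 a (λ x _ _ → count-map P (x ∷_) (boundedWords ν)) ⟩
  sumRange (λ x → countWords ν (P ∘ (x ∷_))) 1 a ∎
  where
  open ≡-Reasoning
  words : ℕ → List (List ℕ)
  words x = map (x ∷_) (boundedWords ν)

-- Q (a ∷ ν) x for any first row a ≥ x (Q-cons).
Q∷ : List ℕ → ℕ → Poly
Q∷ ν x d = countWords ν (λ τ → unique (x ∷ τ) ∧ does (ascFrom x τ ≟ d))

Q-count : ∀ ν j d → Q ν j d ≡ countWords ν (λ σ → unique σ ∧ (does (startsWith? j σ) ∧ does (asc σ ≟ d)))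
Q-count ν j d = trans (length-filter≡count _ (S ν)) (count-filter unique? _ (boundedWords ν))

Q-cons : ∀ {a j} ν → 1 ≤ j → j ≤ a → Q (a ∷ ν) j ≐ Q∷ ν j
Q-cons {a} {j} ν 1≤j j≤a d = begin
  Q (a ∷ ν) j d             ≡⟨ Q-count (a ∷ ν) j d ⟩
  countWords (a ∷ ν) counted ≡⟨ countWords-cons a ν counted ⟩
  sumRange startingWith 1 a  ≡⟨ sumRange-single 1 a j 1≤j (s≤s j≤a) others ⟩
  startingWith j             ≡⟨ count-cong (boundedWords ν) (λ τ →
                                  cong (λ b → unique (j ∷ τ) ∧ (b ∧ does (ascFrom j τ ≟ d))) (dec-true (j ≟ j) refl)) ⟩
  Q∷ ν j d                   ∎
  where
  open ≡-Reasoning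
  counted : List ℕ → Bool
  counted σ = unique σ ∧ (does (startsWith? j σ) ∧ does (asc σ ≟ d))
  startingWith : ℕ → ℕ
  startingWith x = countWords ν (λ τ → unique (x ∷ τ) ∧ (does (x ≟ j) ∧ does (ascFrom x τ ≟ d)))
  others : ∀ k → k ≢ j → startingWith k ≡ 0
  others k k≢j = count-false (boundedWords ν) (λ τ →
    trans (cong (λ b → unique (k ∷ τ) ∧ (b ∧ does (ascFrom k τ ≟ d))) (dec-false (k ≟ j) k≢j))
          (∧-zeroʳ (unique (k ∷ τ))))

countWords-punchIn : ∀ i ν → All (i ≤_) ν → ∀ P →
  countWords (map suc ν) (λ τ → avoids (suc i) τ ∧ P τ) ≡ countWords ν (P ∘ map (punchIn (suc i)))
countWords-punchIn i []      []          P = refl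
countWords-punchIn i (a ∷ ν) (i≤a ∷ i≤ν) P = begin
  countWords (suc a ∷ map suc ν) (λ τ → avoids p τ ∧ P τ)       ≡⟨ countWords-cons (suc a) (map suc ν) _ ⟩
  sumRange startingWith 1 (suc a)                              ≡⟨ sumRange-punchIn startingWith 1 i≤a ⟩
  startingWith p + sumRange (startingWith ∘ punchIn p) 1 a     ≡⟨ cong₂ _+_ startingWith-p
                                                                   (sumRange-cong 1 a (λ y _ _ → startingWith-punchIn y)) ⟩
  sumRange (λ y → countWords ν (λ ρ → P (map (punchIn p) (y ∷ ρ)))) 1 a ≡⟨ sym (countWords-cons a ν _) ⟩
  countWords (a ∷ ν) (P ∘ map (punchIn p))                     ∎
  where
  open ≡-Reasoning
  p = suc i
  startingWith : ℕ → ℕ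
  startingWith x = countWords (map suc ν) (λ τ → avoids p (x ∷ τ) ∧ P (x ∷ τ))
  startingWith-p : startingWith p ≡ 0
  startingWith-p = count-false (boundedWords (map suc ν))
    (λ τ → cong (λ b → (not b ∧ avoids p τ) ∧ P (p ∷ τ)) (dec-true (p ≟ p) refl))
  startingWith-punchIn : ∀ y → startingWith (punchIn p y) ≡ countWords ν (λ ρ → P (map (punchIn p) (y ∷ ρ)))
  startingWith-punchIn y = trans
    (count-cong (boundedWords (map suc ν)) (λ τ → cong (λ b → (not b ∧ avoids p τ) ∧ P (punchIn p y ∷ τ))
      (dec-false (p ≟ punchIn p y) (punchIn-≢ p y ∘ sym))))
    (countWords-punchIn i ν i≤ν (λ τ → P (punchIn p y ∷ τ)))

unique-punchIn : ∀ p ρ → unique (map (punchIn p) ρ) ≡ unique ρ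
unique-punchIn p ρ = does-⇔ (mk⇔ Unique.map⁻ (Unique.map⁺ (strictMono⇒injective (punchIn-mono-< p))))
                            (unique? (map (punchIn p) ρ)) (unique? ρ)

ascFrom-punchIn : ∀ p x σ → ascFrom (punchIn p x) (map (punchIn p) σ) ≡ ascFrom x σ
ascFrom-punchIn p x []      = refl
ascFrom-punchIn p x (y ∷ σ) = cong₂ (λ b n → (if b then 1 else 0) + n)
  (does-⇔ (mk⇔ (strictMono⇒cancel-< (punchIn-mono-< p)) (punchIn-mono-< p))
          (punchIn p x <? punchIn p y) (x <? y))
  (ascFrom-punchIn p y σ)

pivot<punchIn⇔ : ∀ p y → p < punchIn p y ⇔ p ≤ y
pivot<punchIn⇔ p y with y <? p
... | yes y<p = mk⇔ (λ p<y → contradiction (<-trans p<y y<p) (<-irrefl refl))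
                    (λ p≤y → contradiction y<p (≤⇒≯ p≤y))
... | no  _   = mk⇔ s≤s⁻¹ s≤s

ascFrom-pivot-punchIn : ∀ p y τ →
  ascFrom p (map (punchIn p) (y ∷ τ)) ≡ (if does (p ≤? y) then 1 else 0) + ascFrom y τ
ascFrom-pivot-punchIn p y τ = cong₂ (λ b n → (if b then 1 else 0) + n)
  (does-⇔ (pivot<punchIn⇔ p y) (p <? punchIn p y) (p ≤? y)) (ascFrom-punchIn p y τ)

ascFrom-pivot-punchIn-< : ∀ {p y} τ → y < p → ascFrom p (map (punchIn p) (y ∷ τ)) ≡ ascFrom y τ
ascFrom-pivot-punchIn-< {p} {y} τ y<p = trans (ascFrom-pivot-punchIn p y τ)
  (cong (λ b → (if b then 1 else 0) + ascFrom y τ) (dec-false (p ≤? y) (<⇒≱ y<p)))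

ascFrom-pivot-punchIn-≥ : ∀ {p y} τ → p ≤ y → ascFrom p (map (punchIn p) (y ∷ τ)) ≡ suc (ascFrom y τ)
ascFrom-pivot-punchIn-≥ {p} {y} τ p≤y = trans (ascFrom-pivot-punchIn p y τ)
  (cong (λ b → (if b then 1 else 0) + ascFrom y τ) (dec-true (p ≤? y) p≤y))

Q∷-punchIn : ∀ {i ν} → All (i ≤_) ν → ∀ d →
  Q∷ (map suc ν) (suc i) d ≡ countWords ν (λ ρ → unique ρ ∧ does (ascFrom (suc i) (map (punchIn (suc i)) ρ) ≟ d))
Q∷-punchIn {i} {ν} i≤ν d = begin
  countWords (map suc ν) (λ τ → (avoids p τ ∧ unique τ) ∧ ascents p τ)
    ≡⟨ count-cong (boundedWords (map suc ν)) (λ τ → ∧-assoc (avoids p τ) (unique τ) (ascents p τ)) ⟩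
  countWords (map suc ν) (λ τ → avoids p τ ∧ (unique τ ∧ ascents p τ))
    ≡⟨ countWords-punchIn i ν i≤ν (λ τ → unique τ ∧ ascents p τ) ⟩
  countWords ν (λ ρ → unique (map (punchIn p) ρ) ∧ ascents p (map (punchIn p) ρ))
    ≡⟨ count-cong (boundedWords ν) (λ ρ → cong (_∧ ascents p (map (punchIn p) ρ)) (unique-punchIn p ρ)) ⟩
  countWords ν (λ ρ → unique ρ ∧ ascents p (map (punchIn p) ρ))
    ∎
  where
  open ≡-Reasoning
  p = suc i
  ascents : ℕ → List ℕ → Bool
  ascents x τ = does (ascFrom x τ ≟ d)

t·-Q∷ : ∀ ν x d → (t· Q∷ ν x) d ≡ countWords ν (λ τ → unique (x ∷ τ) ∧ does (suc (ascFrom x τ) ≟ d))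
t·-Q∷ ν x zero    = sym (count-false (boundedWords ν) (λ τ → ∧-zeroʳ (unique (x ∷ τ))))
t·-Q∷ ν x (suc d) = refl

ΣQ-cons : ∀ {a} ν b c → 1 ≤ b → b ≤ suc c → c ≤ a → ∀ d →
  ΣQ (a ∷ ν) b c d ≡ sumRange (λ j → Q∷ ν j d) b (suc c ∸ b)
ΣQ-cons {a} ν b c 1≤b b≤1+c c≤a d = trans (sum-fromTo (λ j → Q (a ∷ ν) j d) b c)
  (sumRange-cong b (suc c ∸ b) (λ k b≤k k<b+n → Q-cons ν (≤-trans 1≤b b≤k) (k≤a k<b+n) d))
  where
  k≤a : ∀ {k} → k < b + (suc c ∸ b) → k ≤ a
  k≤a {k} k<b+n = ≤-trans (s≤s⁻¹ (subst (k <_) (m+[n∸m]≡n b≤1+c) k<b+n)) c≤a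

t·-ΣQ-cons : ∀ {a} ν b c → 1 ≤ b → b ≤ suc c → c ≤ a → ∀ d →
  (t· ΣQ (a ∷ ν) b c) d ≡ sumRange (λ j → (t· Q∷ ν j) d) b (suc c ∸ b)
t·-ΣQ-cons ν b c _   _     _   zero    = sym (sumRange-zero b (suc c ∸ b) (λ _ _ → refl))
t·-ΣQ-cons ν b c 1≤b b≤1+c c≤a (suc d) = ΣQ-cons ν b c 1≤b b≤1+c c≤a d

lemma2p4 : (l₁ : ℕ) (ls : List ℕ) (m : ℕ) (i : ℕ) →
    All (0 <_) (l₁ ∷ ls) →
    Linked _≤_ (l₁ ∷ ls) →
    ((r : Fin (length (l₁ ∷ ls))) → suc (toℕ r) ≤ lookup (l₁ ∷ ls) r) →
    1 ≤ m → m ≤ suc l₁ →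
    1 ≤ i → i ≤ m →
    Q (m ∷ map suc (l₁ ∷ ls)) i ≐ (ΣQ (l₁ ∷ ls) 1 (i ∸ 1) ⊕ (t· ΣQ (l₁ ∷ ls) i l₁))
lemma2p4 l₁ ls m (suc i) _ sorted _ _ m≤1+l₁ 1≤p p≤m d = begin
  Q (m ∷ map suc ν) p d
    ≡⟨ Q-cons (map suc ν) 1≤p p≤m d ⟩
  Q∷ (map suc ν) p d
    ≡⟨ Q∷-punchIn (Linked⇒All ≤-trans i≤l₁ sorted) d ⟩
  countWords ν (λ ρ → unique ρ ∧ does (ascFrom p (map (punchIn p) ρ) ≟ d))
    ≡⟨ countWords-cons l₁ ls _ ⟩
  sumRange startingWith 1 l₁
    ≡⟨ cong (sumRange startingWith 1) (sym (m+[n∸m]≡n i≤l₁)) ⟩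
  sumRange startingWith 1 (i + (l₁ ∸ i))
    ≡⟨ sumRange-+ startingWith 1 i (l₁ ∸ i) ⟩
  sumRange startingWith 1 i + sumRange startingWith p (l₁ ∸ i)
    ≡⟨ cong₂ _+_ below above ⟩
  sumRange (λ j → Q∷ ls j d) 1 i + sumRange (λ j → (t· Q∷ ls j) d) p (l₁ ∸ i)
    ≡⟨ sym (cong₂ _+_ (ΣQ-cons ls 1 i ≤-refl (s≤s z≤n) i≤l₁ d) (t·-ΣQ-cons ls p l₁ 1≤p (s≤s i≤l₁) ≤-refl d)) ⟩
  ΣQ ν 1 i d + (t· ΣQ ν p l₁) d
    ∎
  where
  open ≡-Reasoning
  ν = l₁ ∷ ls
  p = suc i
  i≤l₁ : i ≤ l₁
  i≤l₁ = s≤s⁻¹ (≤-trans p≤m m≤1+l₁)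
  startingWith : ℕ → ℕ
  startingWith y = countWords ls (λ τ → unique (y ∷ τ) ∧ does (ascFrom p (map (punchIn p) (y ∷ τ)) ≟ d))
  below : sumRange startingWith 1 i ≡ sumRange (λ j → Q∷ ls j d) 1 i
  below = sumRange-cong 1 i (λ y _ y<p → count-cong (boundedWords ls)
    (λ τ → cong (λ n → unique (y ∷ τ) ∧ does (n ≟ d)) (ascFrom-pivot-punchIn-< τ y<p)))
  above : sumRange startingWith p (l₁ ∸ i) ≡ sumRange (λ j → (t· Q∷ ls j) d) p (l₁ ∸ i)
  above = sumRange-cong p (l₁ ∸ i) (λ y p≤y _ → trans (count-cong (boundedWords ls)
    (λ τ → cong (λ n → unique (y ∷ τ) ∧ does (n ≟ d)) (ascFrom-pivot-punchIn-≥ τ p≤y))) (sym (t·-Q∷ ls y d)))
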